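{- Let $n\ge 1$. The power graph $P(S_{n})$ of the symmetric group $S_n$ is $\{P_{5}, \overline{P_{5}}\}$-free if and only if $n\leq 5$.
   Context: The power graph $P(G)$ of a group $G$ has vertex set $G$, with distinct $u,v$ adjacent if and only if $u=v^m$ or $v=u^n$ for some positive integers $m,n$. $P_5$ is the path on $5$ vertices and $\overline{P_5}$ its complement. A graph is $\{H_1,H_2\}$-free if it contains no induced subgraph isomorphic to $H_1$ and none isomorphic to $H_2$. -}

module Defs where

open import Data.Nat using (ℕ; zero; suc; _+_; _<_)
open import Data.Fin using (Fin; toℕ)
open import Data.Fin.Permutation using (Permutation′; id; _∘ₚ_; _≈_)
open import Data.Product using (Σ; ∃; _×_)
open import Data.Sum using (_⊎_)
open import Relation.Nullary using (¬_)
open import Relation.Binary.PropositionalEquality using (_≡_; _≢_)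
open import Function.Bundles using (_⇔_)

-- Elements of the symmetric group S_n: permutations of Fin n,
-- compared by (extensional) equality _≈_.
Sym : ℕ → Set
Sym n = Permutation′ n

pow : ∀ {n} → Sym n → ℕ → Sym n
pow π zero    = id
pow π (suc k) = π ∘ₚ pow π k

PowerAdj : ∀ {n} → Sym n → Sym n → Set
PowerAdj u v =
  ¬ (u ≈ v) ×
  ((∃ λ m → 0 < m × u ≈ pow v m) ⊎ (∃ λ k → 0 < k × v ≈ pow u k))

P5Adj : Fin 5 → Fin 5 → Set
P5Adj i j = suc (toℕ i) ≡ toℕ j ⊎ suc (toℕ j) ≡ toℕ i

-- Adjacency of the complement of P_5 (for distinct vertices).
coP5Adj : Fin 5 → Fin 5 → Set
coP5Adj i j = ¬ P5Adj i j

HasInduced : (Fin 5 → Fin 5 → Set) → ℕ → Set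
HasInduced H n =
  Σ (Fin 5 → Sym n) λ f →
    (∀ i j → f i ≈ f j → i ≡ j) ×
    (∀ i j → i ≢ j → (PowerAdj (f i) (f j) ⇔ H i j))

PowerGraphSymP5Free : ℕ → Set
PowerGraphSymP5Free n = ¬ HasInduced P5Adj n × ¬ HasInduced coP5Adj n

-- For n ≤ 5 it suffices to look at S₅: S_m embeds into S_n for m ≤ n, and injective
-- homomorphisms carry induced subgraphs of power graphs along. Write u ≼ v when u is a positive
-- power of v. Every element of S₅ has order at most 6, which makes ≼ very shallow: there is no
-- chain 1 < ⟨x⟩ < ⟨y⟩ < ⟨z⟩, and if ⟨z⟩ contains x together with an element incomparable to x
-- (so z has order 6), then every cyclic subgroup strictly above ⟨x⟩ lies in ⟨z⟩. The second fact
-- already excludes a path a – b – c – d with a ≁ c and b ≁ d, hence an induced P₅. In the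
-- complement of the path 0 – 1 – 2 – 3 – 4 the vertices 0, 2, 4 form a triangle of nontrivial
-- elements, so by the first fact two of them generate the same cyclic subgroup and therefore have
-- the same neighbours; but each pair among 0, 2, 4 is separated by vertex 1 or 3. The facts about
-- S₅ are verified by exhaustive computation on permutation tables. For n ≥ 6, an explicit
-- induced P₅ in P(S₆) is carried into P(S_n).

module Submission where

open import Defs
open import Data.Bool using (Bool; true; T) renaming (_≟_ to _≟ᵇ_)
open import Data.Bool.Properties using (T-≡)
open import Data.Empty using (⊥)
open import Data.Fin using (Fin; suc; toℕ; fromℕ<; _≟_)
open import Data.Fin.Patterns using (0F; 1F; 2F; 3F; 4F; 5F)
open import Data.Fin.Permutation
  using (id; _∘ₚ_; _≈_; _⟨$⟩ʳ_; _⟨$⟩ˡ_; inverseˡ; transpose; lift₀; lift₀-cong; lift₀-comp; lift₀-id)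
import Data.Fin.Properties as Fin
open import Data.Nat using (ℕ; zero; suc; _+_; _*_; _<_; _≤_; _≤′_; ≤′-reflexive; ≤′-step; z≤n; s≤s)
  renaming (_≟_ to _≟ℕ_)
open import Data.Nat.Properties using (m≤n⇒m<n∨m≡n; ≤-<-trans; *-zeroʳ; *-suc; ≮⇒≥; ≤⇒≤′)
open import Data.Product using (∃; _×_; _,_; proj₁; proj₂; map₂) renaming (swap to ≋-sym)
open import Data.Sum using (_⊎_; inj₁; inj₂; [_,_]; swap) renaming (map to ⊎-map)
open import Data.Vec using (Vec; []; _∷_; lookup; map; tabulate; allFin)
open import Data.Vec.Properties using (≡-dec; lookup∘tabulate; tabulate-cong; tabulate-∘)
open import Data.Vec.Relation.Unary.Any using (any?)
import Data.Vec.Relation.Unary.All as All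
open import Data.Vec.Relation.Unary.Unique.Propositional using (Unique; []; _∷_)
open import Data.Vec.Relation.Unary.Unique.Propositional.Properties using (tabulate⁺)
open import Function.Base using (_∘_)
open import Function.Bundles using (_⇔_; mk⇔; Equivalence)
open import Function.Properties.Equivalence using () renaming (trans to ⇔-trans; sym to ⇔-sym)
open import Level using (0ℓ)
open import Relation.Binary.PropositionalEquality using (_≡_; _≢_; refl; sym; trans; cong; module ≡-Reasoning)
open import Relation.Nullary using (¬_; Dec; isYes; yes; no; contradiction)
open import Relation.Nullary.Decidable
  using (True; False; toWitness; toWitnessFalse; ¬?; _×-dec_; _⊎-dec_; _→-dec_)
open import Relation.Unary using (Pred; Decidable)
open import Relation.Binary.Bundles using (Setoid)
import Relation.Binary.Reasoning.Setoid as ≈-Reasoning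

Sym-setoid : ℕ → Setoid 0ℓ 0ℓ
Sym-setoid n = record
  { Carrier       = Sym n
  ; _≈_           = _≈_
  ; isEquivalence = record
    { refl  = λ _ → refl
    ; sym   = λ e i → sym (e i)
    ; trans = λ e e′ i → trans (e i) (e′ i)
    }
  }

module _ {n : ℕ} where

  open ≈-Reasoning (Sym-setoid n)

  pow-cong : {π σ : Sym n} → π ≈ σ → ∀ m → pow π m ≈ pow σ m
  pow-cong e zero    i = refl
  pow-cong {π} {σ} e (suc m) i = trans (cong (pow π m ⟨$⟩ʳ_) (e i)) (pow-cong e m (σ ⟨$⟩ʳ i))

  pow-+ : ∀ (π : Sym n) a b → pow π (a + b) ≈ pow π a ∘ₚ pow π b
  pow-+ π zero    b i = refl
  pow-+ π (suc a) b i = pow-+ π a b (π ⟨$⟩ʳ i)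

  pow-* : ∀ (π : Sym n) a b → pow (pow π a) b ≈ pow π (a * b)
  pow-* π a zero    i rewrite *-zeroʳ a = refl
  pow-* π a (suc b) i rewrite *-suc a b =
    trans (pow-* π a b (pow π a ⟨$⟩ʳ i)) (sym (pow-+ π a (a * b) i))

  pow-mod : ∀ {π : Sym n} {o} → pow π (suc o) ≈ id →
            ∀ m → ∃ λ i → i ≤ o × pow π (suc m) ≈ pow π (suc i)
  pow-mod e zero = 0 , z≤n , λ _ → refl
  pow-mod {π} {o} e (suc m) with pow-mod e m
  ... | i , i≤o , πᵐ≈πⁱ with m≤n⇒m<n∨m≡n i≤o
  ...   | inj₁ i<o  = suc i , i<o , λ j → πᵐ≈πⁱ (π ⟨$⟩ʳ j)
  ...   | inj₂ refl = 0 , z≤n , λ j → trans (πᵐ≈πⁱ (π ⟨$⟩ʳ j)) (e (π ⟨$⟩ʳ j))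

  infix 4 _≼_ _∼_ _≋_

  data _≼_ (u v : Sym n) : Set where
    power : ∀ m → u ≈ pow v (suc m) → u ≼ v

  _∼_ : Sym n → Sym n → Set
  u ∼ v = u ≼ v ⊎ v ≼ u

  _≋_ : Sym n → Sym n → Set
  u ≋ v = u ≼ v × v ≼ u

  ≼-trans : {x y z : Sym n} → x ≼ y → y ≼ z → x ≼ z
  ≼-trans {x} {y} {z} (power m x≈) (power m′ y≈) = power (m + m′ * suc m) (begin
    x                             ≈⟨ x≈ ⟩
    pow y (suc m)                 ≈⟨ pow-cong y≈ (suc m) ⟩
    pow (pow z (suc m′)) (suc m)  ≈⟨ pow-* z (suc m′) (suc m) ⟩
    pow z (suc m′ * suc m)        ∎)

  PowerAdj⇔∼ : {u v : Sym n} → PowerAdj u v ⇔ (¬ u ≈ v × u ∼ v)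
  PowerAdj⇔∼ = mk⇔ (map₂ (⊎-map fromExponent fromExponent)) (map₂ (⊎-map toExponent toExponent))
    where
    fromExponent : {u v : Sym n} → (∃ λ m → 0 < m × u ≈ pow v m) → u ≼ v
    fromExponent (suc m , _ , e) = power m e
    toExponent : {u v : Sym n} → u ≼ v → ∃ λ m → 0 < m × u ≈ pow v m
    toExponent (power m e) = suc m , s≤s z≤n , e

  ≋-∼ : {x y w : Sym n} → x ≋ y → w ∼ x → w ∼ y
  ≋-∼ (x≼y , _)   (inj₁ w≼x) = inj₁ (≼-trans w≼x x≼y)
  ≋-∼ (_   , y≼x) (inj₂ x≼w) = inj₂ (≼-trans y≼x x≼w)

  ≈id⇒≼ : {u v : Sym n} → id ≼ v → u ≈ id → u ≼ v
  ≈id⇒≼ (power m id≈) u≈id = power m (λ i → trans (u≈id i) (id≈ i))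

  OrderAtMost : ℕ → Sym n → Set
  OrderAtMost k π = ∃ λ o → o < k × pow π (suc o) ≈ id

  id≼ : ∀ {k} {π : Sym n} → OrderAtMost k π → id ≼ π
  id≼ (o , _ , e) = power o (λ i → sym (e i))

  ≼-bounded : ∀ {k} {x y : Sym n} → OrderAtMost k y → x ≼ y → ∃ λ i → i < k × x ≈ pow y (suc i)
  ≼-bounded (o , o<k , e) (power m x≈) with pow-mod e m
  ... | i , i≤o , eq = i , ≤-<-trans i≤o o<k , λ j → trans (x≈ j) (eq j)

  NoLongPowerChains : Set
  NoLongPowerChains = ∀ {x y z : Sym n} → ¬ x ≈ id → x ≼ y → y ≼ z → y ≼ x ⊎ z ≼ y

  SplitPowerCap : Set
  SplitPowerCap = ∀ {x y z w : Sym n} → x ≼ z → y ≼ z → ¬ x ∼ y → x ≼ w → ¬ w ≼ x → w ≼ z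

  no-induced-P₄ : SplitPowerCap → {a b c d : Sym n} →
                  a ∼ b → b ∼ c → c ∼ d → ¬ a ∼ c → ¬ b ∼ d → ⊥
  no-induced-P₄ cap ab (inj₁ b≼c) cd a≁c b≁d = oriented ab b≼c cd a≁c b≁d
    where
    oriented : {a b c d : Sym n} → a ∼ b → b ≼ c → c ∼ d → ¬ a ∼ c → ¬ b ∼ d → ⊥
    oriented (inj₁ a≼b) b≼c _          a≁c _   = a≁c (inj₁ (≼-trans a≼b b≼c))
    oriented (inj₂ b≼a) b≼c (inj₁ c≼d) _   b≁d = b≁d (inj₁ (≼-trans b≼c c≼d))
    oriented (inj₂ b≼a) b≼c (inj₂ d≼c) a≁c b≁d =
      a≁c (inj₁ (cap b≼c d≼c b≁d b≼a (λ a≼b → a≁c (inj₁ (≼-trans a≼b b≼c)))))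
  no-induced-P₄ cap ab (inj₂ c≼b) cd a≁c b≁d =
    no-induced-P₄ cap (swap cd) (inj₁ c≼b) (swap ab) (b≁d ∘ swap) (a≁c ∘ swap)

  chain⇒twins : NoLongPowerChains → {x y z : Sym n} → ¬ x ≈ id → x ≼ y → y ≼ z → x ≋ y ⊎ y ≋ z
  chain⇒twins chains x≉id x≼y y≼z = ⊎-map (x≼y ,_) (y≼z ,_) (chains x≉id x≼y y≼z)

  triangle-twins : NoLongPowerChains → {x y z : Sym n} → ¬ x ≈ id → ¬ y ≈ id → ¬ z ≈ id →
                   x ∼ y → y ∼ z → x ∼ z → x ≋ y ⊎ y ≋ z ⊎ x ≋ z
  triangle-twins ch x≉id _ _ (inj₁ x≼y) (inj₁ y≼z) _ =
    [ inj₁ , inj₂ ∘ inj₁ ] (chain⇒twins ch x≉id x≼y y≼z)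
  triangle-twins ch x≉id _ _ (inj₁ x≼y) (inj₂ z≼y) (inj₁ x≼z) =
    [ inj₂ ∘ inj₂ , inj₂ ∘ inj₁ ∘ ≋-sym ] (chain⇒twins ch x≉id x≼z z≼y)
  triangle-twins ch _ _ z≉id (inj₁ x≼y) (inj₂ z≼y) (inj₂ z≼x) =
    [ inj₂ ∘ inj₂ ∘ ≋-sym , inj₁ ] (chain⇒twins ch z≉id z≼x x≼y)
  triangle-twins ch _ y≉id _ (inj₂ y≼x) (inj₁ y≼z) (inj₁ x≼z) =
    [ inj₁ ∘ ≋-sym , inj₂ ∘ inj₂ ] (chain⇒twins ch y≉id y≼x x≼z)
  triangle-twins ch _ y≉id _ (inj₂ y≼x) (inj₁ y≼z) (inj₂ z≼x) =
    [ inj₂ ∘ inj₁ , inj₂ ∘ inj₂ ∘ ≋-sym ] (chain⇒twins ch y≉id y≼z z≼x)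
  triangle-twins ch _ _ z≉id (inj₂ y≼x) (inj₂ z≼y) _ =
    [ inj₂ ∘ inj₁ ∘ ≋-sym , inj₁ ∘ ≋-sym ] (chain⇒twins ch z≉id z≼y y≼x)

P5Adj? : ∀ i j → Dec (P5Adj i j)
P5Adj? i j = (suc (toℕ i) ≟ℕ toℕ j) ⊎-dec (suc (toℕ j) ≟ℕ toℕ i)

coP5Adj? : ∀ i j → Dec (coP5Adj i j)
coP5Adj? i j = ¬? (P5Adj? i j)

module InducedCopy {H : Fin 5 → Fin 5 → Set} (H? : ∀ i j → Dec (H i j))
                   {n : ℕ} (copy : HasInduced H n) where

  f : Fin 5 → Sym n
  f = proj₁ copy

  f-injective : ∀ i j → f i ≈ f j → i ≡ j
  f-injective = proj₁ (proj₂ copy)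

  f-adjacency : ∀ i j → i ≢ j → PowerAdj (f i) (f j) ⇔ H i j
  f-adjacency = proj₂ (proj₂ copy)

  edge : ∀ i j {i≢j : False (i ≟ j)} {h : True (H? i j)} → f i ∼ f j
  edge i j {i≢j} {h} =
    proj₂ (Equivalence.to PowerAdj⇔∼ (Equivalence.from (f-adjacency i j (toWitnessFalse i≢j)) (toWitness h)))

  nonedge : ∀ i j {i≢j : False (i ≟ j)} {¬h : False (H? i j)} → ¬ f i ∼ f j
  nonedge i j {i≢j} {¬h} fi∼fj = toWitnessFalse ¬h (Equivalence.to (f-adjacency i j i≢j′)
    (Equivalence.from PowerAdj⇔∼ (i≢j′ ∘ f-injective i j , fi∼fj)))
    where
    i≢j′ : i ≢ j
    i≢j′ = toWitnessFalse i≢j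

¬inducedP₅ : ∀ {n} → SplitPowerCap {n} → ¬ HasInduced P5Adj n
¬inducedP₅ cap copy = no-induced-P₄ cap (edge 0F 1F) (edge 1F 2F) (edge 2F 3F) (nonedge 0F 2F) (nonedge 1F 3F)
  where open InducedCopy P5Adj? copy

¬inducedCoP₅ : ∀ {n} → (∀ (π : Sym n) → id ≼ π) → NoLongPowerChains {n} → ¬ HasInduced coP5Adj n
¬inducedCoP₅ id≼π chains copy = separated
  (triangle-twins chains (nontrivial 0F 1F) (nontrivial 2F 1F) (nontrivial 4F 3F)
                         (edge 0F 2F) (edge 2F 4F) (edge 0F 4F))
  where
  open InducedCopy coP5Adj? copy
  nontrivial : ∀ i j {i≢j : False (i ≟ j)} {¬h : False (coP5Adj? i j)} → ¬ f i ≈ id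
  nontrivial i j {i≢j} {¬h} fi≈id = nonedge i j {i≢j} {¬h} (inj₁ (≈id⇒≼ (id≼π (f j)) fi≈id))
  separated : f 0F ≋ f 2F ⊎ f 2F ≋ f 4F ⊎ f 0F ≋ f 4F → ⊥
  separated (inj₁ 0≋2)        = nonedge 3F 2F (≋-∼ 0≋2 (edge 3F 0F))
  separated (inj₂ (inj₁ 2≋4)) = nonedge 1F 2F (≋-∼ (≋-sym 2≋4) (edge 1F 4F))
  separated (inj₂ (inj₂ 0≋4)) = nonedge 3F 4F (≋-∼ 0≋4 (edge 3F 0F))

module Embedding {m n : ℕ} (φ : Sym m → Sym n)
                 (φ-cong : ∀ π σ → π ≈ σ → φ π ≈ φ σ)
                 (φ-injective : ∀ π σ → φ π ≈ φ σ → π ≈ σ)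
                 (φ-∘ : ∀ π σ → φ (π ∘ₚ σ) ≈ φ π ∘ₚ φ σ)
                 (φ-id : φ id ≈ id) where

  open ≈-Reasoning (Sym-setoid n)

  φ-pow : ∀ π k → pow (φ π) k ≈ φ (pow π k)
  φ-pow π zero    i = sym (φ-id i)
  φ-pow π (suc k) = begin
    φ π ∘ₚ pow (φ π) k     ≈⟨ (λ i → φ-pow π k (φ π ⟨$⟩ʳ i)) ⟩
    φ π ∘ₚ φ (pow π k)     ≈⟨ φ-∘ π (pow π k) ⟨
    φ (π ∘ₚ pow π k)       ∎

  ≼-map : ∀ {u v} → u ≼ v → φ u ≼ φ v
  ≼-map {u} {v} (power k e) = power k (begin
    φ u                    ≈⟨ φ-cong u _ e ⟩
    φ (pow v (suc k))      ≈⟨ φ-pow v (suc k) ⟨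
    pow (φ v) (suc k)      ∎)

  ≼-reflect : ∀ {u v} → φ u ≼ φ v → u ≼ v
  ≼-reflect {u} {v} (power k e) = power k (φ-injective u _ (begin
    φ u                    ≈⟨ e ⟩
    pow (φ v) (suc k)      ≈⟨ φ-pow v (suc k) ⟩
    φ (pow v (suc k))      ∎))

  PowerAdj-φ : ∀ {u v} → PowerAdj (φ u) (φ v) ⇔ PowerAdj u v
  PowerAdj-φ {u} {v} = ⇔-trans PowerAdj⇔∼ (⇔-trans (mk⇔
    (λ (φu≉φv , c) → φu≉φv ∘ φ-cong u v , ⊎-map ≼-reflect ≼-reflect c)
    (λ (u≉v , c) → u≉v ∘ φ-injective u v , ⊎-map ≼-map ≼-map c)) (⇔-sym PowerAdj⇔∼))

  HasInduced-map : ∀ {H} → HasInduced H m → HasInduced H n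
  HasInduced-map (f , f-injective , f-adj) =
    φ ∘ f ,
    (λ i j e → f-injective i j (φ-injective (f i) (f j) e)) ,
    (λ i j i≢j → ⇔-trans PowerAdj-φ (f-adj i j i≢j))

HasInduced-suc : ∀ {H n} → HasInduced H n → HasInduced H (suc n)
HasInduced-suc = HasInduced-map
  where
  open Embedding lift₀ lift₀-cong (λ _ _ e i → Fin.suc-injective (e (suc i)))
                 (λ π σ i → sym (lift₀-comp π σ i)) lift₀-id

HasInduced-mono : ∀ {H m n} → m ≤ n → HasInduced H m → HasInduced H n
HasInduced-mono m≤n = go (≤⇒≤′ m≤n)
  where
  go : ∀ {H m n} → m ≤′ n → HasInduced H m → HasInduced H n
  go (≤′-reflexive refl) = λ copy → copy
  go (≤′-step m≤′n)      = HasInduced-suc ∘ go m≤′n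

Table : ℕ → Set
Table n = Vec (Fin n) n

module _ {n : ℕ} where

  table : Sym n → Table n
  table π = tabulate (π ⟨$⟩ʳ_)

  idᵗ : Table n
  idᵗ = allFin n

  _∘ᵗ_ : Table n → Table n → Table n
  s ∘ᵗ t = map (lookup t) s

  powᵗ : Table n → ℕ → Table n
  powᵗ t zero    = idᵗ
  powᵗ t (suc k) = t ∘ᵗ powᵗ t k

  _≟ᵗ_ : (s t : Table n) → Dec (s ≡ t)
  _≟ᵗ_ = ≡-dec _≟_

  table-cong : {π σ : Sym n} → π ≈ σ → table π ≡ table σ
  table-cong = tabulate-cong

  table-injective : {π σ : Sym n} → table π ≡ table σ → π ≈ σ
  table-injective {π} {σ} e i =
    trans (sym (lookup∘tabulate (π ⟨$⟩ʳ_) i)) (trans (cong (λ t → lookup t i) e) (lookup∘tabulate (σ ⟨$⟩ʳ_) i))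

  table-∘ : ∀ (π σ : Sym n) → table (π ∘ₚ σ) ≡ table π ∘ᵗ table σ
  table-∘ π σ = trans (tabulate-cong (λ i → sym (lookup∘tabulate (σ ⟨$⟩ʳ_) (π ⟨$⟩ʳ i))))
                      (tabulate-∘ (lookup (table σ)) (π ⟨$⟩ʳ_))

  table-pow : ∀ (π : Sym n) k → table (pow π k) ≡ powᵗ (table π) k
  table-pow π zero    = refl
  table-pow π (suc k) = trans (table-∘ π (pow π k)) (cong (table π ∘ᵗ_) (table-pow π k))

  -- The exponent bound 6 suffices because no permutation in S₅ or S₆ has order above 6.
  _≼ᵗ_ : Table n → Table n → Set
  s ≼ᵗ t = ∃ λ (i : Fin 6) → s ≡ powᵗ t (suc (toℕ i))

  _≼ᵗ?_ : (s t : Table n) → Dec (s ≼ᵗ t)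
  s ≼ᵗ? t = Fin.any? (λ i → s ≟ᵗ powᵗ t (suc (toℕ i)))

  _∼ᵗ_ : Table n → Table n → Set
  s ∼ᵗ t = s ≼ᵗ t ⊎ t ≼ᵗ s

  _∼ᵗ?_ : (s t : Table n) → Dec (s ∼ᵗ t)
  s ∼ᵗ? t = (s ≼ᵗ? t) ⊎-dec (t ≼ᵗ? s)

  ≼ᵗ-sound : {x y : Sym n} → table x ≼ᵗ table y → x ≼ y
  ≼ᵗ-sound {x} {y} (i , e) =
    power (toℕ i) (table-injective {x} {pow y (suc (toℕ i))} (trans e (sym (table-pow y (suc (toℕ i))))))

  ∼ᵗ-sound : {x y : Sym n} → table x ∼ᵗ table y → x ∼ y
  ∼ᵗ-sound = ⊎-map ≼ᵗ-sound ≼ᵗ-sound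

  ≼ᵗ-complete : {x y : Sym n} → OrderAtMost 6 y → x ≼ y → table x ≼ᵗ table y
  ≼ᵗ-complete {x} {y} ord x≼y with ≼-bounded ord x≼y
  ... | i , i<6 , x≈ = fromℕ< i<6 , (begin
    table x                                  ≡⟨ table-cong {x} {pow y (suc i)} x≈ ⟩
    table (pow y (suc i))                    ≡⟨ table-pow y (suc i) ⟩
    powᵗ (table y) (suc i)                   ≡⟨ cong (powᵗ (table y) ∘ suc) (Fin.toℕ-fromℕ< i<6) ⟨
    powᵗ (table y) (suc (toℕ (fromℕ< i<6)))  ∎)
    where open ≡-Reasoning

  OrderAtMostᵗ : Table n → Set
  OrderAtMostᵗ t = ∃ λ (o : Fin 6) → powᵗ t (suc (toℕ o)) ≡ idᵗ

  orderᵗ? : (t : Table n) → Dec (OrderAtMostᵗ t)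
  orderᵗ? t = Fin.any? (λ o → powᵗ t (suc (toℕ o)) ≟ᵗ idᵗ)

  orderᵗ-sound : {π : Sym n} → OrderAtMostᵗ (table π) → OrderAtMost 6 π
  orderᵗ-sound {π} (o , e) =
    toℕ o , Fin.toℕ<n o , table-injective {pow π (suc (toℕ o))} {id} (trans (table-pow π (suc (toℕ o))) e)

  AllPowers : Pred (Table n) 0ℓ → Pred (Table n) 0ℓ
  AllPowers P t = ∀ (i : Fin 6) → P (powᵗ t (suc (toℕ i)))

  allPowers? : {P : Pred (Table n) 0ℓ} → Decidable P → Decidable (AllPowers P)
  allPowers? P? t = Fin.all? (λ i → P? (powᵗ t (suc (toℕ i))))

  everyPower : (P : Pred (Table n) 0ℓ) {s t : Table n} → AllPowers P t → s ≼ᵗ t → P s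
  everyPower P all (i , refl) = all i

  -- Opaque, so that the searches are unfolded only where they are run (below), never on
  -- symbolic tables, where unfolding them exhausts memory.
  opaque
    allUnique : ∀ k {P : Pred (Vec (Fin n) k) 0ℓ} → Decidable P → Bool
    allUnique zero    P? = isYes (P? [])
    allUnique (suc k) P? = allUnique k (λ v → Fin.all? (λ a → any? (a ≟_) v ⊎-dec P? (a ∷ v)))

    allUnique-sound : ∀ k {P : Pred (Vec (Fin n) k) 0ℓ} (P? : Decidable P) →
                      T (allUnique k P?) → ∀ {v} → Unique v → P v
    allUnique-sound zero    P? accepted []                 = toWitness accepted
    allUnique-sound (suc k) P? accepted {a ∷ v} (a∉v ∷ v!) with allUnique-sound k _ accepted v! a
    ... | inj₁ a∈v = contradiction refl (All.lookup a∉v a∈v)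
    ... | inj₂ Pav = Pav

    allPerms : {P : Pred (Table n) 0ℓ} → Decidable P → Bool
    allPerms = allUnique n

    allPerms-sound : {P : Pred (Table n) 0ℓ} (P? : Decidable P) → allPerms P? ≡ true → ∀ π → P (table π)
    allPerms-sound P? accepted π = allUnique-sound n P? (Equivalence.from T-≡ accepted)
      (tabulate⁺ λ {i} {j} e → trans (sym (inverseˡ π)) (trans (cong (π ⟨$⟩ˡ_) e) (inverseˡ π)))

decided : {A : Set} (a? : Dec A) → isYes a? ≡ true → A
decided a? = toWitness ∘ Equivalence.from T-≡

ChainFree : ∀ {n} → Table n → Table n → Table n → Set
ChainFree z y x = x ≡ idᵗ ⊎ y ≼ᵗ x ⊎ z ≼ᵗ y

ChainsFrom : ∀ {n} → Table n → Table n → Set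
ChainsFrom z y = AllPowers (ChainFree z y) y

chainsFrom? : ∀ {n} (z : Table n) → Decidable (ChainsFrom z)
chainsFrom? z y = allPowers? (λ x → (x ≟ᵗ idᵗ) ⊎-dec (y ≼ᵗ? x) ⊎-dec (z ≼ᵗ? y)) y

CappedAbove : ∀ {n} → Table n → Table n → Table n → Set
CappedAbove z x w = x ≼ᵗ w → w ≼ᵗ x ⊎ w ≼ᵗ z

cappedAbove? : ∀ {n} (z x : Table n) → Decidable (CappedAbove z x)
cappedAbove? z x w = (x ≼ᵗ? w) →-dec ((w ≼ᵗ? x) ⊎-dec (w ≼ᵗ? z))

SplitCapped : ∀ {n} → Table n → Table n → Set
SplitCapped z x = AllPowers (x ∼ᵗ_) z ⊎ allPerms (cappedAbove? z x) ≡ true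

splitCapped? : ∀ {n} (z : Table n) → Decidable (SplitCapped z)
splitCapped? z x = allPowers? (x ∼ᵗ?_) z ⊎-dec (allPerms (cappedAbove? z x) ≟ᵇ true)

opaque
  unfolding allPerms

  S₅-order≤6 : ∀ (π : Sym 5) → OrderAtMost 6 π
  S₅-order≤6 = orderᵗ-sound ∘ allPerms-sound orderᵗ? refl

  S₅-chains : ∀ (z : Sym 5) → AllPowers (ChainsFrom (table z)) (table z)
  S₅-chains = allPerms-sound (λ z → allPowers? (chainsFrom? z) z) refl

  S₅-splitCapped : ∀ (z : Sym 5) → AllPowers (SplitCapped (table z)) (table z)
  S₅-splitCapped = allPerms-sound (λ z → allPowers? (splitCapped? z) z) refl

≼ᵗ₅-complete : {x y : Sym 5} → x ≼ y → table x ≼ᵗ table y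
≼ᵗ₅-complete = ≼ᵗ-complete (S₅-order≤6 _)

S₅-noLongPowerChains : NoLongPowerChains {5}
S₅-noLongPowerChains {x} {y} {z} x≉id x≼y y≼z = conclude
  (everyPower (ChainFree (table z) (table y))
    (everyPower (ChainsFrom (table z)) (S₅-chains z) (≼ᵗ₅-complete y≼z)) (≼ᵗ₅-complete x≼y))
  where
  conclude : ChainFree (table z) (table y) (table x) → y ≼ x ⊎ z ≼ y
  conclude (inj₁ x≡id)       = contradiction (table-injective {π = x} {σ = id} x≡id) x≉id
  conclude (inj₂ (inj₁ y≼x)) = inj₁ (≼ᵗ-sound y≼x)
  conclude (inj₂ (inj₂ z≼y)) = inj₂ (≼ᵗ-sound z≼y)

S₅-splitPowerCap : SplitPowerCap {5}
S₅-splitPowerCap {x} {y} {z} {w} x≼z y≼z x≁y x≼w w⋠x =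
  conclude (everyPower (SplitCapped (table z)) (S₅-splitCapped z) (≼ᵗ₅-complete x≼z))
  where
  above : table w ≼ᵗ table x ⊎ table w ≼ᵗ table z → w ≼ z
  above (inj₁ w≼x) = contradiction (≼ᵗ-sound w≼x) w⋠x
  above (inj₂ w≼z) = ≼ᵗ-sound w≼z
  conclude : SplitCapped (table z) (table x) → w ≼ z
  conclude (inj₁ comparable) =
    contradiction (∼ᵗ-sound (everyPower (table x ∼ᵗ_) comparable (≼ᵗ₅-complete y≼z))) x≁y
  conclude (inj₂ capped) =
    above (allPerms-sound (cappedAbove? (table z) (table x)) capped w (≼ᵗ₅-complete x≼w))

InducesP₅ : ∀ {n} → (Fin 5 → Table n) → Set
InducesP₅ t = ∀ i j → i ≢ j → ¬ t i ≡ t j × (t i ∼ᵗ t j → P5Adj i j) × (P5Adj i j → t i ∼ᵗ t j)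

inducesP₅? : ∀ {n} (t : Fin 5 → Table n) → Dec (InducesP₅ t)
inducesP₅? t = Fin.all? λ i → Fin.all? λ j → ¬? (i ≟ j) →-dec
  ¬? (t i ≟ᵗ t j) ×-dec (t i ∼ᵗ? t j →-dec P5Adj? i j) ×-dec (P5Adj? i j →-dec t i ∼ᵗ? t j)

-- (1 2 3) — (1 2 3)(4 5) — (4 5) — (0 1 2)(4 5) — (0 1 2)
S₆-path : Fin 5 → Sym 6
S₆-path 0F = transpose 1F 2F ∘ₚ transpose 2F 3F
S₆-path 1F = transpose 1F 2F ∘ₚ transpose 2F 3F ∘ₚ transpose 4F 5F
S₆-path 2F = transpose 4F 5F
S₆-path 3F = transpose 0F 1F ∘ₚ transpose 1F 2F ∘ₚ transpose 4F 5F
S₆-path 4F = transpose 0F 1F ∘ₚ transpose 1F 2F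

S₆-inducedP₅ : HasInduced P5Adj 6
S₆-inducedP₅ = S₆-path , injective , adjacency
  where
  checked : InducesP₅ (table ∘ S₆-path)
  checked = decided (inducesP₅? (table ∘ S₆-path)) refl
  order≤6 : ∀ i → OrderAtMost 6 (S₆-path i)
  order≤6 i = orderᵗ-sound (decided (Fin.all? (orderᵗ? ∘ table ∘ S₆-path)) refl i)
  distinct : ∀ i j → i ≢ j → ¬ S₆-path i ≈ S₆-path j
  distinct i j i≢j e = proj₁ (checked i j i≢j) (table-cong {π = S₆-path i} {σ = S₆-path j} e)
  injective : ∀ i j → S₆-path i ≈ S₆-path j → i ≡ j
  injective i j e with i ≟ j
  ... | yes i≡j = i≡j
  ... | no i≢j  = contradiction e (distinct i j i≢j)
  adjacency : ∀ i j → i ≢ j → PowerAdj (S₆-path i) (S₆-path j) ⇔ P5Adj i j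
  adjacency i j i≢j = ⇔-trans PowerAdj⇔∼ (mk⇔
    (λ (_ , c) → proj₁ (proj₂ (checked i j i≢j))
                   (⊎-map (≼ᵗ-complete (order≤6 j)) (≼ᵗ-complete (order≤6 i)) c))
    (λ p → distinct i j i≢j , ∼ᵗ-sound (proj₂ (proj₂ (checked i j i≢j)) p)))

mainTheorem12 : ∀ (n : ℕ) → 1 ≤ n → (PowerGraphSymP5Free n ⇔ n ≤ 5)
mainTheorem12 n _ = mk⇔
  (λ (noP₅ , _) → ≮⇒≥ λ 5<n → noP₅ (HasInduced-mono 5<n S₆-inducedP₅))
  (λ n≤5 → (¬inducedP₅ S₅-splitPowerCap ∘ HasInduced-mono n≤5) ,
           (¬inducedCoP₅ (id≼ ∘ S₅-order≤6) S₅-noLongPowerChains ∘ HasInduced-mono n≤5))
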